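{- Let $R\in\mathbb R^{n\times n}$ be an irreducible nonnegative matrix with positive left and right eigenvectors $u$ and $v$ for the PF eigenvalue $1$. Then for every positive integer $k$, \[ \phi(R^k)\le k\cdot\phi(R). \]
   Context: For a nonnegative matrix $M$ having $u$ and $v$ as left and right eigenvectors for eigenvalue $1$ (as $R^k$ does), $\phi(M)=\min\{\phi_S(M):S\ne\emptyset,\ \sum_{i\in S}u_iv_i\le\frac12\sum_iu_iv_i\}$ with $\phi_S(M)=\frac{\langle\mathbf 1_S,D_uMD_v\mathbf 1_{\overline S}\rangle}{\langle\mathbf 1_S,D_uMD_v\mathbf 1\rangle}$, where $D_x=\mathrm{diag}(x)$, $\mathbf 1_S$ is the indicator vector of $S$, $\mathbf 1$ the all-ones vector. -}

module Defs where

open import Level using (Level; _⊔_; suc)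
open import Data.Nat as ℕ using (ℕ; zero)
open import Data.Fin using (Fin) renaming (zero to fzero; suc to fsuc)
open import Data.Bool using (Bool; true; false; if_then_else_; not)
open import Data.Product using (_×_; Σ; ∃; ∃-syntax)
open import Relation.Binary.PropositionalEquality using (_≡_; _≢_)
open import Relation.Binary.Structures using (IsTotalOrder)
open import Relation.Nullary using (¬_)
open import Algebra.Structures using (IsCommutativeRing)

-- An ordered field (entries of the matrices; ℝ is an instance).
-- Inverse is total; the field axiom only constrains it on nonzero elements.
record OrderedField (c ℓ : Level) : Set (Level.suc (c ⊔ ℓ)) where
  infixl 7 _*_
  infixl 6 _+_
  infix 4 _≤_
  field
    Carrier : Set c
    _+_ _*_ : Carrier → Carrier → Carrier
    -_ _⁻¹  : Carrier → Carrier
    0# 1#   : Carrier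
    _≤_     : Carrier → Carrier → Set ℓ
    isCommutativeRing : IsCommutativeRing _≡_ _+_ _*_ -_ 0# 1#
    0≢1     : 0# ≢ 1#
    ⁻¹-inverse : ∀ x → x ≢ 0# → x * (x ⁻¹) ≡ 1#
    isTotalOrder : IsTotalOrder _≡_ _≤_
    +-mono-≤ : ∀ {x y} z → x ≤ y → x + z ≤ y + z
    *-nonneg : ∀ {x y} → 0# ≤ x → 0# ≤ y → 0# ≤ x * y

  _<_ : Carrier → Carrier → Set (c ⊔ ℓ)
  x < y = x ≤ y × x ≢ y

module _ {c ℓ} (F : OrderedField c ℓ) where
  open OrderedField F

  Σ[_] : (n : ℕ) → (Fin n → Carrier) → Carrier
  Σ[ zero ] f = 0#
  Σ[ ℕ.suc n ] f = f fzero + Σ[ n ] (λ i → f (fsuc i))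

  Matrix : ℕ → Set c
  Matrix n = Fin n → Fin n → Carrier

  Vector : ℕ → Set c
  Vector n = Fin n → Carrier

  Subset : ℕ → Set
  Subset n = Fin n → Bool

  ∁ : ∀ {n} → Subset n → Subset n
  ∁ S i = not (S i)

  full : ∀ {n} → Subset n
  full i = true

  Nonempty : ∀ {n} → Subset n → Set
  Nonempty S = ∃[ i ] S i ≡ true

  𝟙 : ∀ {n} → Subset n → Vector n
  𝟙 S i = if S i then 1# else 0#

  identity : ∀ {n} → Matrix n
  identity {ℕ.suc n} fzero fzero = 1#
  identity {ℕ.suc n} (fsuc i) (fsuc j) = identity {n} i j
  identity {ℕ.suc n} _ _ = 0#

  _⊗_ : ∀ {n} → Matrix n → Matrix n → Matrix n
  _⊗_ {n} A B i j = Σ[ n ] (λ l → A i l * B l j)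

  _^_ : ∀ {n} → Matrix n → ℕ → Matrix n
  M ^ zero = identity
  M ^ ℕ.suc k = M ⊗ (M ^ k)

  fromℕ : ℕ → Carrier
  fromℕ zero = 0#
  fromℕ (ℕ.suc k) = 1# + fromℕ k

  Nonnegative : ∀ {n} → Matrix n → Set ℓ
  Nonnegative M = ∀ i j → 0# ≤ M i j

  Positive : ∀ {n} → Vector n → Set (c ⊔ ℓ)
  Positive x = ∀ i → 0# < x i

  Irreducible : ∀ {n} → Matrix n → Set (c ⊔ ℓ)
  Irreducible M = ∀ i j → ∃[ m ] (0# < (M ^ m) i j)

  LeftEigen1 : ∀ {n} → Matrix n → Vector n → Set c
  LeftEigen1 {n} M u = ∀ j → Σ[ n ] (λ i → u i * M i j) ≡ u j

  RightEigen1 : ∀ {n} → Matrix n → Vector n → Set c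
  RightEigen1 {n} M v = ∀ i → Σ[ n ] (λ j → M i j * v j) ≡ v i

  form : ∀ {n} → Vector n → Vector n → Matrix n → Vector n → Vector n → Carrier
  form {n} u v M x y = Σ[ n ] (λ i → Σ[ n ] (λ j → x i * (u i * M i j * v j) * y j))

  φ-set : ∀ {n} → Vector n → Vector n → Matrix n → Subset n → Carrier
  φ-set u v M S = form u v M (𝟙 S) (𝟙 (∁ S)) * (form u v M (𝟙 S) (𝟙 full)) ⁻¹

  Admissible : ∀ {n} → Vector n → Vector n → Subset n → Set ℓ
  Admissible {n} u v S =
    Nonempty S × (Σ[ n ] (λ i → 𝟙 S i * (u i * v i)) ≤ (fromℕ 2) ⁻¹ * Σ[ n ] (λ i → u i * v i))

  IsPhi : ∀ {n} → Vector n → Vector n → Matrix n → Carrier → Set (c ⊔ ℓ)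
  IsPhi u v M φ =
    (∃[ S ] (Admissible u v S × φ-set u v M S ≡ φ)) ×
    (∀ S → Admissible u v S → φ ≤ φ-set u v M S)

{-# OPTIONS --safe #-}
-- Write φ_T(M) = cut_M(T) / vol(T) with vol(T) = Σ_{i∈T} u_i v_i: the denominator
-- ⟨1_T, D_u M D_v 1⟩ equals vol(T) as soon as Mv = v, so it is the same for R and R^k.
-- A path i → l → j from T to its complement leaves T at its first or at its second
-- step; weighting paths by u_i R_il (R^k)_lj v_j and using uR = u, R^k v = v gives
-- cut_{R^(k+1)}(T) ≤ cut_R(T) + cut_{R^k}(T), hence cut_{R^k}(T) ≤ k cut_R(T).
-- Admissibility of T does not depend on the matrix, so for T attaining φ(R)
-- we get φ(R^k) ≤ φ_T(R^k) ≤ k φ_T(R) = k φ(R).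
module Submission where

open import Defs
open import Data.Nat using (ℕ; zero; suc)
open import Data.Fin using (Fin) renaming (zero to fzero; suc to fsuc)
open import Data.Bool using (Bool; true; false; not; if_then_else_)
open import Data.Product using (_,_; proj₁)
open import Data.Sum using (inj₁; inj₂)
open import Data.Empty using (⊥-elim)
open import Relation.Binary.PropositionalEquality
  using (_≡_; refl; sym; trans; cong; cong₂; subst; subst₂; ≢-sym; module ≡-Reasoning)
open import Relation.Binary.Bundles using (Poset)
open import Relation.Binary.Structures using (IsTotalOrder)
open import Algebra.Bundles using (CommutativeRing)

module OrderedFieldProperties {c ℓ} (F : OrderedField c ℓ) where
  open OrderedField F renaming (+-mono-≤ to +-monoˡ-≤)
  open IsTotalOrder isTotalOrder public using (total; antisym)
    renaming (refl to ≤-refl; trans to ≤-trans)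

  commutativeRing : CommutativeRing c c
  commutativeRing = record { isCommutativeRing = isCommutativeRing }

  open CommutativeRing commutativeRing
    using (_-_; +-comm; +-identityˡ; +-identityʳ; -‿inverseʳ; *-identityʳ; zeroˡ; +-group; ring)
  open import Algebra.Properties.Group +-group using (⁻¹-involutive; //-rightDividesˡ)
  open import Algebra.Properties.Ring ring using (-‿distribˡ-*; -‿distribʳ-*; [y-z]x≈yx-zx)

  poset : Poset c c ℓ
  poset = record { isPartialOrder = IsTotalOrder.isPartialOrder isTotalOrder }

  +-monoʳ-≤ : ∀ z {x y} → x ≤ y → z + x ≤ z + y
  +-monoʳ-≤ z {x} {y} x≤y = subst₂ _≤_ (+-comm x z) (+-comm y z) (+-monoˡ-≤ z x≤y)

  +-mono-≤ : ∀ {x y z w} → x ≤ y → z ≤ w → x + z ≤ y + w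
  +-mono-≤ {y = y} {z = z} x≤y z≤w = ≤-trans (+-monoˡ-≤ z x≤y) (+-monoʳ-≤ y z≤w)

  +-nonneg : ∀ {x y} → 0# ≤ x → 0# ≤ y → 0# ≤ x + y
  +-nonneg {x} {y} 0≤x 0≤y = subst (_≤ x + y) (+-identityˡ 0#) (+-mono-≤ 0≤x 0≤y)

  x≤x+y : ∀ x {y} → 0# ≤ y → x ≤ x + y
  x≤x+y x {y} 0≤y = subst (_≤ x + y) (+-identityʳ x) (+-monoʳ-≤ x 0≤y)

  x≤y⇒0≤y-x : ∀ {x y} → x ≤ y → 0# ≤ y - x
  x≤y⇒0≤y-x {x} {y} x≤y = subst (_≤ y - x) (-‿inverseʳ x) (+-monoˡ-≤ (- x) x≤y)

  0≤y-x⇒x≤y : ∀ {x y} → 0# ≤ y - x → x ≤ y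
  0≤y-x⇒x≤y {x} {y} 0≤y-x = subst₂ _≤_ (+-identityˡ x) (//-rightDividesˡ x y) (+-monoˡ-≤ x 0≤y-x)

  x≤0⇒0≤-x : ∀ {x} → x ≤ 0# → 0# ≤ - x
  x≤0⇒0≤-x {x} x≤0 = subst (0# ≤_) (+-identityˡ (- x)) (x≤y⇒0≤y-x x≤0)

  *-monoʳ-≤-nonneg : ∀ {z x y} → 0# ≤ z → x ≤ y → x * z ≤ y * z
  *-monoʳ-≤-nonneg {z} {x} {y} 0≤z x≤y =
    0≤y-x⇒x≤y (subst (0# ≤_) ([y-z]x≈yx-zx z y x) (*-nonneg (x≤y⇒0≤y-x x≤y) 0≤z))

  x*x-nonneg : ∀ x → 0# ≤ x * x
  x*x-nonneg x with total 0# x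
  ... | inj₁ 0≤x = *-nonneg 0≤x 0≤x
  ... | inj₂ x≤0 = subst (0# ≤_) -x*-x≡x*x (*-nonneg (x≤0⇒0≤-x x≤0) (x≤0⇒0≤-x x≤0))
    where
    -x*-x≡x*x : - x * - x ≡ x * x
    -x*-x≡x*x = trans (sym (-‿distribˡ-* x (- x)))
                      (trans (cong -_ (sym (-‿distribʳ-* x x))) (⁻¹-involutive (x * x)))

  0≤1 : 0# ≤ 1#
  0≤1 = subst (0# ≤_) (*-identityʳ 1#) (x*x-nonneg 1#)

  <-≤-trans : ∀ {x y z} → x < y → y ≤ z → x < z
  <-≤-trans (x≤y , x≢y) y≤z =
    ≤-trans x≤y y≤z , λ { refl → x≢y (antisym x≤y y≤z) }

  *-pos : ∀ {x y} → 0# < x → 0# < y → 0# < (x * y)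
  *-pos {x} {y} (0≤x , 0≢x) (0≤y , 0≢y) = *-nonneg 0≤x 0≤y , λ 0≡xy → 0≢1 (begin
      0#                       ≡⟨ sym (zeroˡ _) ⟩
      0# * (x ⁻¹ * y ⁻¹)       ≡⟨ cong (_* (x ⁻¹ * y ⁻¹)) 0≡xy ⟩
      x * y * (x ⁻¹ * y ⁻¹)    ≡⟨ solve 4 (λ x y x′ y′ → x :* y :* (x′ :* y′) := (x :* x′) :* (y :* y′))
                                        refl x y (x ⁻¹) (y ⁻¹) ⟩
      x * x ⁻¹ * (y * y ⁻¹)    ≡⟨ cong₂ _*_ (⁻¹-inverse x (≢-sym 0≢x)) (⁻¹-inverse y (≢-sym 0≢y)) ⟩
      1# * 1#                  ≡⟨ *-identityʳ 1# ⟩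
      1#                       ∎)
    where
    open ≡-Reasoning
    open import Algebra.Solver.Ring.NaturalCoefficients.Default
      (CommutativeRing.commutativeSemiring commutativeRing)

  ⁻¹-nonneg : ∀ {x} → 0# < x → 0# ≤ x ⁻¹
  ⁻¹-nonneg {x} (0≤x , 0≢x) with total 0# (x ⁻¹)
  ... | inj₁ 0≤x⁻¹ = 0≤x⁻¹
  ... | inj₂ x⁻¹≤0 = ⊥-elim (0≢1 (antisym 0≤1 1≤0))
    where
    0≤-1 : 0# ≤ - 1#
    0≤-1 = subst (0# ≤_) (trans (sym (-‿distribʳ-* x (x ⁻¹))) (cong -_ (⁻¹-inverse x (≢-sym 0≢x))))
                 (*-nonneg 0≤x (x≤0⇒0≤-x x⁻¹≤0))
    1≤0 : 1# ≤ 0#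
    1≤0 = subst₂ _≤_ (+-identityʳ 1#) (-‿inverseʳ 1#) (+-monoʳ-≤ 1# 0≤-1)

module FiniteSums {c ℓ} (F : OrderedField c ℓ) where
  open OrderedField F renaming (+-mono-≤ to +-monoˡ-≤)
  open OrderedFieldProperties F
  open CommutativeRing commutativeRing
    using (+-identityˡ; +-identityʳ; *-comm; zeroʳ; distribˡ)
  open import Algebra.Solver.Ring.NaturalCoefficients.Default
    (CommutativeRing.commutativeSemiring commutativeRing)

  -- The field, not the length, fills the hole of the mixfix Σ[_] outside Defs.
  sum : (n : ℕ) → Vector F n → Carrier
  sum = Σ[_] F

  sum-cong : ∀ {n} {f g : Vector F n} → (∀ i → f i ≡ g i) → sum n f ≡ sum n g
  sum-cong {zero} f≗g = refl
  sum-cong {suc n} f≗g = cong₂ _+_ (f≗g fzero) (sum-cong (λ i → f≗g (fsuc i)))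

  sum-zero : ∀ n → sum n (λ _ → 0#) ≡ 0#
  sum-zero zero = refl
  sum-zero (suc n) = trans (cong (0# +_) (sum-zero n)) (+-identityʳ 0#)

  sum-distrib-+ : ∀ {n} (f g : Vector F n) → sum n (λ i → f i + g i) ≡ sum n f + sum n g
  sum-distrib-+ {zero} f g = sym (+-identityˡ 0#)
  sum-distrib-+ {suc n} f g =
    trans (cong (f fzero + g fzero +_) (sum-distrib-+ (λ i → f (fsuc i)) (λ i → g (fsuc i))))
          (solve 4 (λ a b c d → (a :+ b) :+ (c :+ d) := (a :+ c) :+ (b :+ d)) refl
                 (f fzero) (g fzero) (sum n (λ i → f (fsuc i))) (sum n (λ i → g (fsuc i))))

  *-distribˡ-sum : ∀ {n} a (f : Vector F n) → a * sum n f ≡ sum n (λ i → a * f i)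
  *-distribˡ-sum {zero} a f = zeroʳ a
  *-distribˡ-sum {suc n} a f =
    trans (distribˡ a (f fzero) _) (cong (a * f fzero +_) (*-distribˡ-sum a (λ i → f (fsuc i))))

  *-distribʳ-sum : ∀ {n} a (f : Vector F n) → sum n f * a ≡ sum n (λ i → f i * a)
  *-distribʳ-sum a f =
    trans (*-comm _ a) (trans (*-distribˡ-sum a f) (sum-cong (λ i → *-comm a (f i))))

  sum-comm : ∀ {m n} (f : Fin m → Fin n → Carrier) →
             sum m (λ i → sum n (λ j → f i j)) ≡ sum n (λ j → sum m (λ i → f i j))
  sum-comm {zero} {n} f = sym (sum-zero n)
  sum-comm {suc m} f =
    trans (cong (sum _ (f fzero) +_) (sum-comm (λ i → f (fsuc i))))
          (sym (sum-distrib-+ (f fzero) _))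

  sum-mono-≤ : ∀ {n} {f g : Vector F n} → (∀ i → f i ≤ g i) → sum n f ≤ sum n g
  sum-mono-≤ {zero} f≤g = ≤-refl
  sum-mono-≤ {suc n} f≤g = +-mono-≤ (f≤g fzero) (sum-mono-≤ (λ i → f≤g (fsuc i)))

  sum-nonneg : ∀ {n} {f : Vector F n} → (∀ i → 0# ≤ f i) → 0# ≤ sum n f
  sum-nonneg {zero} 0≤f = ≤-refl
  sum-nonneg {suc n} 0≤f = +-nonneg (0≤f fzero) (sum-nonneg (λ i → 0≤f (fsuc i)))

  term≤sum : ∀ {n} {f : Vector F n} → (∀ i → 0# ≤ f i) → ∀ i → f i ≤ sum n f
  term≤sum {suc n} 0≤f fzero = x≤x+y _ (sum-nonneg (λ i → 0≤f (fsuc i)))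
  term≤sum {suc n} {f} 0≤f (fsuc i) =
    ≤-trans (term≤sum (λ i → 0≤f (fsuc i)) i)
            (subst (_≤ f fzero + rest) (+-identityˡ rest) (+-monoˡ-≤ rest (0≤f fzero)))
    where
    rest : Carrier
    rest = sum n (λ i → f (fsuc i))

module MatrixProperties {c ℓ} (F : OrderedField c ℓ) where
  open OrderedField F renaming (+-mono-≤ to +-monoˡ-≤)
  open OrderedFieldProperties F
  open FiniteSums F
  open CommutativeRing commutativeRing using (+-identityˡ; +-identityʳ; *-identityˡ; zeroˡ; *-assoc)

  sum-identity : ∀ {n} (f : Vector F n) i → sum n (λ j → identity F i j * f j) ≡ f i
  sum-identity {suc n} f fzero = begin
    1# * f fzero + sum n (λ j → 0# * f (fsuc j)) ≡⟨ cong₂ _+_ (*-identityˡ _) (sum-cong (λ j → zeroˡ (f (fsuc j)))) ⟩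
    f fzero + sum n (λ _ → 0#)                   ≡⟨ cong (f fzero +_) (sum-zero n) ⟩
    f fzero + 0#                                 ≡⟨ +-identityʳ _ ⟩
    f fzero                                      ∎
    where open ≡-Reasoning
  sum-identity {suc n} f (fsuc i) =
    trans (cong₂ _+_ (zeroˡ _) (sum-identity (λ j → f (fsuc j)) i)) (+-identityˡ _)

  identity-nonneg : ∀ {n} → Nonnegative F (identity F {n})
  identity-nonneg {suc n} fzero fzero = 0≤1
  identity-nonneg {suc n} fzero (fsuc j) = ≤-refl
  identity-nonneg {suc n} (fsuc i) fzero = ≤-refl
  identity-nonneg {suc n} (fsuc i) (fsuc j) = identity-nonneg i j

  ⊗-nonneg : ∀ {n} {A B : Matrix F n} → Nonnegative F A → Nonnegative F B → Nonnegative F (_⊗_ F A B)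
  ⊗-nonneg A≥0 B≥0 i j = sum-nonneg (λ l → *-nonneg (A≥0 i l) (B≥0 l j))

  ⊗-rightEigen1 : ∀ {n} {A B : Matrix F n} {v : Vector F n} →
                  RightEigen1 F A v → RightEigen1 F B v → RightEigen1 F (_⊗_ F A B) v
  ⊗-rightEigen1 {n} {A} {B} {v} Av≡v Bv≡v i = begin
    sum n (λ j → sum n (λ l → A i l * B l j) * v j)   ≡⟨ sum-cong (λ j → *-distribʳ-sum (v j) (λ l → A i l * B l j)) ⟩
    sum n (λ j → sum n (λ l → A i l * B l j * v j))   ≡⟨ sum-comm (λ j l → A i l * B l j * v j) ⟩
    sum n (λ l → sum n (λ j → A i l * B l j * v j))   ≡⟨ sum-cong (λ l → sum-cong (λ j → *-assoc (A i l) (B l j) (v j))) ⟩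
    sum n (λ l → sum n (λ j → A i l * (B l j * v j))) ≡⟨ sum-cong (λ l → sym (*-distribˡ-sum (A i l) (λ j → B l j * v j))) ⟩
    sum n (λ l → A i l * sum n (λ j → B l j * v j))   ≡⟨ sum-cong (λ l → cong (A i l *_) (Bv≡v l)) ⟩
    sum n (λ l → A i l * v l)                         ≡⟨ Av≡v i ⟩
    v i                                               ∎
    where open ≡-Reasoning

  ^-nonneg : ∀ {n} {R : Matrix F n} → Nonnegative F R → ∀ k → Nonnegative F (_^_ F R k)
  ^-nonneg R≥0 zero = identity-nonneg
  ^-nonneg R≥0 (suc k) = ⊗-nonneg R≥0 (^-nonneg R≥0 k)

  ^-rightEigen1 : ∀ {n} {R : Matrix F n} {v : Vector F n} → RightEigen1 F R v → ∀ k → RightEigen1 F (_^_ F R k) v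
  ^-rightEigen1 {v = v} Rv≡v zero = sum-identity v
  ^-rightEigen1 Rv≡v (suc k) = ⊗-rightEigen1 Rv≡v (^-rightEigen1 Rv≡v k)

module Conductance {c ℓ} (F : OrderedField c ℓ) {n : ℕ} (u v : Vector F n) where
  open OrderedField F renaming (+-mono-≤ to +-monoˡ-≤)
  open OrderedFieldProperties F
  open FiniteSums F
  open MatrixProperties F
  open CommutativeRing commutativeRing
    using (+-identityˡ; +-identityʳ; *-identityˡ; *-identityʳ; zeroˡ; zeroʳ; *-assoc; distribʳ)
  open import Algebra.Solver.Ring.NaturalCoefficients.Default
    (CommutativeRing.commutativeSemiring commutativeRing)
  open import Relation.Binary.Reasoning.PartialOrder poset

  cut : Matrix F n → Subset F n → Carrier
  cut M T = form F u v M (𝟙 F T) (𝟙 F (∁ F T))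

  volume : Subset F n → Carrier
  volume T = sum n (λ i → 𝟙 F T i * (u i * v i))

  form-full≡volume : ∀ {M} T → RightEigen1 F M v → form F u v M (𝟙 F T) (𝟙 F (full F)) ≡ volume T
  form-full≡volume {M} T Mv≡v = sum-cong λ i → begin-equality
    sum n (λ j → a i * (u i * M i j * v j) * 1#) ≡⟨ sum-cong (λ j → reassoc (a i) (u i) (M i j) (v j)) ⟩
    sum n (λ j → a i * u i * (M i j * v j))      ≡⟨ *-distribˡ-sum (a i * u i) (λ j → M i j * v j) ⟨
    a i * u i * sum n (λ j → M i j * v j)        ≡⟨ cong (a i * u i *_) (Mv≡v i) ⟩
    a i * u i * v i                              ≡⟨ *-assoc (a i) (u i) (v i) ⟩
    a i * (u i * v i)                            ∎
    where
    a : Vector F n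
    a = 𝟙 F T
    reassoc : ∀ x y z w → x * (y * z * w) * 1# ≡ x * y * (z * w)
    reassoc x y z w = trans (*-identityʳ _) (solve 4 (λ x y z w → x :* (y :* z :* w) := x :* y :* (z :* w)) refl x y z w)

  φ-set≡cut*volume⁻¹ : ∀ {M} T → RightEigen1 F M v → φ-set F u v M T ≡ cut M T * volume T ⁻¹
  φ-set≡cut*volume⁻¹ {M} T Mv≡v = cong (λ x → cut M T * x ⁻¹) (form-full≡volume T Mv≡v)

  bit : Bool → Carrier
  bit b = if b then 1# else 0#

  bit-nonneg : ∀ b → 0# ≤ bit b
  bit-nonneg true = 0≤1
  bit-nonneg false = ≤-refl

  𝟙*𝟙∁≡0 : ∀ T (i : Fin n) → 𝟙 F T i * 𝟙 F (∁ F T) i ≡ 0#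
  𝟙*𝟙∁≡0 T i with T i
  ... | true = zeroʳ 1#
  ... | false = zeroˡ 1#

  𝟙-crossing : ∀ T (i l j : Fin n) →
               𝟙 F T i * 𝟙 F (∁ F T) j ≤ 𝟙 F T i * 𝟙 F (∁ F T) l + 𝟙 F T l * 𝟙 F (∁ F T) j
  𝟙-crossing T i l j = crossing (T i) (T l) (T j)
    where
    crossing : ∀ s t r → bit s * bit (not r) ≤ bit s * bit (not t) + bit t * bit (not r)
    crossing false t r = subst (_≤ 0# * bit (not t) + bit t * bit (not r)) (sym (zeroˡ (bit (not r))))
                               (+-nonneg (*-nonneg ≤-refl (bit-nonneg (not t)))
                                         (*-nonneg (bit-nonneg t) (bit-nonneg (not r))))
    crossing true t true = subst (_≤ 1# * bit (not t) + bit t * 0#) (sym (zeroʳ 1#))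
                                 (+-nonneg (*-nonneg 0≤1 (bit-nonneg (not t))) (*-nonneg (bit-nonneg t) ≤-refl))
    crossing true true false =
      subst (1# * 1# ≤_) (sym (trans (cong (_+ 1# * 1#) (zeroʳ 1#)) (+-identityˡ _))) ≤-refl
    crossing true false false =
      subst (1# * 1# ≤_) (sym (trans (cong (1# * 1# +_) (zeroˡ 1#)) (+-identityʳ _))) ≤-refl

  cut-identity : ∀ T → cut (identity F) T ≡ 0#
  cut-identity T = trans (sum-cong diagonal-vanishes) (sum-zero n)
    where
    a b : Vector F n
    a = 𝟙 F T
    b = 𝟙 F (∁ F T)
    diagonal-vanishes : ∀ i → sum n (λ j → a i * (u i * identity F i j * v j) * b j) ≡ 0#
    diagonal-vanishes i = begin-equality
      sum n (λ j → a i * (u i * identity F i j * v j) * b j)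
        ≡⟨ sum-cong (λ j → solve 5 (λ a u e v b → a :* (u :* e :* v) :* b := e :* (a :* u :* (v :* b))) refl
                                   (a i) (u i) (identity F i j) (v j) (b j)) ⟩
      sum n (λ j → identity F i j * (a i * u i * (v j * b j)))
        ≡⟨ sum-identity (λ j → a i * u i * (v j * b j)) i ⟩
      a i * u i * (v i * b i)
        ≡⟨ solve 4 (λ a u v b → a :* u :* (v :* b) := a :* b :* (u :* v)) refl (a i) (u i) (v i) (b i) ⟩
      a i * b i * (u i * v i)
        ≡⟨ cong (_* (u i * v i)) (𝟙*𝟙∁≡0 T i) ⟩
      0# * (u i * v i)
        ≡⟨ zeroˡ _ ⟩
      0# ∎

  sum³ : (Fin n → Fin n → Fin n → Carrier) → Carrier
  sum³ f = sum n (λ i → sum n (λ j → sum n (λ l → f i j l)))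

  pathWeight : Matrix F n → Matrix F n → Fin n → Fin n → Fin n → Carrier
  pathWeight A B i j l = u i * A i l * B l j * v j

  form-⊗≡sum³ : ∀ A B (x y : Vector F n) →
                form F u v (_⊗_ F A B) x y ≡ sum³ (λ i j l → x i * y j * pathWeight A B i j l)
  form-⊗≡sum³ A B x y = sum-cong λ i → sum-cong λ j → begin-equality
    x i * (u i * sum n (λ l → A i l * B l j) * v j) * y j
      ≡⟨ solve 5 (λ x u s v y → x :* (u :* s :* v) :* y := (x :* y :* u :* v) :* s) refl
                 (x i) (u i) (sum n (λ l → A i l * B l j)) (v j) (y j) ⟩
    x i * y j * u i * v j * sum n (λ l → A i l * B l j)
      ≡⟨ *-distribˡ-sum (x i * y j * u i * v j) (λ l → A i l * B l j) ⟩
    sum n (λ l → x i * y j * u i * v j * (A i l * B l j))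
      ≡⟨ sum-cong (λ l → solve 6 (λ x y u v a b → x :* y :* u :* v :* (a :* b) := x :* y :* (u :* a :* b :* v))
                               refl (x i) (y j) (u i) (v j) (A i l) (B l j)) ⟩
    sum n (λ l → x i * y j * pathWeight A B i j l) ∎

  sum³-firstStep≡form : ∀ A {B} → RightEigen1 F B v → ∀ (x y : Vector F n) →
                        sum³ (λ i j l → x i * y l * pathWeight A B i j l) ≡ form F u v A x y
  sum³-firstStep≡form A {B} Bv≡v x y = sum-cong λ i →
    trans (sum-comm (λ j l → x i * y l * pathWeight A B i j l)) (sum-cong λ l → begin-equality
      sum n (λ j → x i * y l * pathWeight A B i j l)
        ≡⟨ sum-cong (λ j → solve 6 (λ x y u a b v → x :* y :* (u :* a :* b :* v) := (x :* y :* u :* a) :* (b :* v))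
                                 refl (x i) (y l) (u i) (A i l) (B l j) (v j)) ⟩
      sum n (λ j → x i * y l * u i * A i l * (B l j * v j))
        ≡⟨ *-distribˡ-sum (x i * y l * u i * A i l) (λ j → B l j * v j) ⟨
      x i * y l * u i * A i l * sum n (λ j → B l j * v j)
        ≡⟨ cong (x i * y l * u i * A i l *_) (Bv≡v l) ⟩
      x i * y l * u i * A i l * v l
        ≡⟨ solve 5 (λ x y u a v → x :* y :* u :* a :* v := x :* (u :* a :* v) :* y) refl (x i) (y l) (u i) (A i l) (v l) ⟩
      x i * (u i * A i l * v l) * y l ∎)

  sum³-secondStep≡form : ∀ {A} B → LeftEigen1 F A u → ∀ (x y : Vector F n) →
                         sum³ (λ i j l → x l * y j * pathWeight A B i j l) ≡ form F u v B x y
  sum³-secondStep≡form {A} B uA≡u x y = begin-equality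
    sum n (λ i → sum n (λ j → sum n (λ l → w i j l)))
      ≡⟨ sum-comm (λ i j → sum n (λ l → w i j l)) ⟩
    sum n (λ j → sum n (λ i → sum n (λ l → w i j l)))
      ≡⟨ sum-cong (λ j → sum-comm (λ i l → w i j l)) ⟩
    sum n (λ j → sum n (λ l → sum n (λ i → w i j l)))
      ≡⟨ sum-comm (λ j l → sum n (λ i → w i j l)) ⟩
    sum n (λ l → sum n (λ j → sum n (λ i → w i j l)))
      ≡⟨ sum-cong (λ l → sum-cong (λ j → absorb l j)) ⟩
    form F u v B x y ∎
    where
    w : Fin n → Fin n → Fin n → Carrier
    w i j l = x l * y j * pathWeight A B i j l
    absorb : ∀ l j → sum n (λ i → w i j l) ≡ x l * (u l * B l j * v j) * y j
    absorb l j = begin-equality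
      sum n (λ i → w i j l)
        ≡⟨ sum-cong (λ i → solve 6 (λ x y u a b v → x :* y :* (u :* a :* b :* v) := (u :* a) :* (x :* y :* b :* v))
                                 refl (x l) (y j) (u i) (A i l) (B l j) (v j)) ⟩
      sum n (λ i → u i * A i l * (x l * y j * B l j * v j))
        ≡⟨ *-distribʳ-sum (x l * y j * B l j * v j) (λ i → u i * A i l) ⟨
      sum n (λ i → u i * A i l) * (x l * y j * B l j * v j)
        ≡⟨ cong (_* (x l * y j * B l j * v j)) (uA≡u l) ⟩
      u l * (x l * y j * B l j * v j)
        ≡⟨ solve 5 (λ u x y b v → u :* (x :* y :* b :* v) := x :* (u :* b :* v) :* y) refl (u l) (x l) (y j) (B l j) (v j) ⟩
      x l * (u l * B l j * v j) * y j ∎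

  sum³-distrib-+ : ∀ (f g : Fin n → Fin n → Fin n → Carrier) →
                   sum³ (λ i j l → f i j l + g i j l) ≡ sum³ f + sum³ g
  sum³-distrib-+ f g = begin-equality
    sum³ (λ i j l → f i j l + g i j l)
      ≡⟨ sum-cong (λ i → sum-cong (λ j → sum-distrib-+ (f i j) (g i j))) ⟩
    sum n (λ i → sum n (λ j → sum n (f i j) + sum n (g i j)))
      ≡⟨ sum-cong (λ i → sum-distrib-+ (λ j → sum n (f i j)) (λ j → sum n (g i j))) ⟩
    sum n (λ i → sum n (λ j → sum n (f i j)) + sum n (λ j → sum n (g i j)))
      ≡⟨ sum-distrib-+ (λ i → sum n (λ j → sum n (f i j))) (λ i → sum n (λ j → sum n (g i j))) ⟩
    sum³ f + sum³ g ∎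

  cut-⊗ : ∀ {A B} → (∀ i → 0# ≤ u i) → (∀ i → 0# ≤ v i) → Nonnegative F A → Nonnegative F B →
          LeftEigen1 F A u → RightEigen1 F B v → ∀ T → cut (_⊗_ F A B) T ≤ cut A T + cut B T
  cut-⊗ {A} {B} u≥0 v≥0 A≥0 B≥0 uA≡u Bv≡v T = begin
    cut (_⊗_ F A B) T
      ≡⟨ form-⊗≡sum³ A B a b ⟩
    sum³ (λ i j l → a i * b j * w i j l)
      ≤⟨ sum-mono-≤ (λ i → sum-mono-≤ (λ j → sum-mono-≤ (λ l →
           *-monoʳ-≤-nonneg (w-nonneg i j l) (𝟙-crossing T i l j)))) ⟩
    sum³ (λ i j l → (a i * b l + a l * b j) * w i j l)
      ≡⟨ sum-cong (λ i → sum-cong (λ j → sum-cong (λ l → distribʳ (w i j l) (a i * b l) (a l * b j)))) ⟩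
    sum³ (λ i j l → a i * b l * w i j l + a l * b j * w i j l)
      ≡⟨ sum³-distrib-+ (λ i j l → a i * b l * w i j l) (λ i j l → a l * b j * w i j l) ⟩
    sum³ (λ i j l → a i * b l * w i j l) + sum³ (λ i j l → a l * b j * w i j l)
      ≡⟨ cong₂ _+_ (sum³-firstStep≡form A Bv≡v a b) (sum³-secondStep≡form B uA≡u a b) ⟩
    cut A T + cut B T ∎
    where
    a b : Vector F n
    a = 𝟙 F T
    b = 𝟙 F (∁ F T)
    w : Fin n → Fin n → Fin n → Carrier
    w = pathWeight A B
    w-nonneg : ∀ i j l → 0# ≤ w i j l
    w-nonneg i j l = *-nonneg (*-nonneg (*-nonneg (u≥0 i) (A≥0 i l)) (B≥0 l j)) (v≥0 j)

  cut-^ : ∀ {R} → (∀ i → 0# ≤ u i) → (∀ i → 0# ≤ v i) → Nonnegative F R →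
          LeftEigen1 F R u → RightEigen1 F R v → ∀ k T → cut (_^_ F R k) T ≤ fromℕ F k * cut R T
  cut-^ {R} u≥0 v≥0 R≥0 uR≡u Rv≡v zero T =
    subst₂ _≤_ (sym (cut-identity T)) (sym (zeroˡ (cut R T))) ≤-refl
  cut-^ {R} u≥0 v≥0 R≥0 uR≡u Rv≡v (suc k) T = begin
    cut (_⊗_ F R (_^_ F R k)) T
      ≤⟨ cut-⊗ u≥0 v≥0 R≥0 (^-nonneg R≥0 k) uR≡u (^-rightEigen1 Rv≡v k) T ⟩
    cut R T + cut (_^_ F R k) T
      ≤⟨ +-monoʳ-≤ (cut R T) (cut-^ u≥0 v≥0 R≥0 uR≡u Rv≡v k T) ⟩
    cut R T + fromℕ F k * cut R T
      ≡⟨ cong (_+ fromℕ F k * cut R T) (*-identityˡ (cut R T)) ⟨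
    1# * cut R T + fromℕ F k * cut R T
      ≡⟨ distribʳ (cut R T) 1# (fromℕ F k) ⟨
    (1# + fromℕ F k) * cut R T ∎

  volume-pos : Positive F u → Positive F v → ∀ {T} → Nonempty F T → 0# < volume T
  volume-pos u>0 v>0 {T} (i , i∈T) = <-≤-trans 0<term (term≤sum term-nonneg i)
    where
    term-nonneg : ∀ j → 0# ≤ 𝟙 F T j * (u j * v j)
    term-nonneg j = *-nonneg (bit-nonneg (T j)) (*-nonneg (proj₁ (u>0 j)) (proj₁ (v>0 j)))
    0<term : 0# < (𝟙 F T i * (u i * v i))
    0<term = subst (λ b → 0# < (bit b * (u i * v i))) (sym i∈T)
                   (subst (0# <_) (sym (*-identityˡ _)) (*-pos (u>0 i) (v>0 i)))

  φ-set-^ : ∀ {R} → Positive F u → Positive F v → Nonnegative F R →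
            LeftEigen1 F R u → RightEigen1 F R v → ∀ k {T} → Nonempty F T →
            φ-set F u v (_^_ F R k) T ≤ fromℕ F k * φ-set F u v R T
  φ-set-^ {R} u>0 v>0 R≥0 uR≡u Rv≡v k {T} T≢∅ = begin
    φ-set F u v (_^_ F R k) T
      ≡⟨ φ-set≡cut*volume⁻¹ T (^-rightEigen1 Rv≡v k) ⟩
    cut (_^_ F R k) T * volume T ⁻¹
      ≤⟨ *-monoʳ-≤-nonneg (⁻¹-nonneg (volume-pos u>0 v>0 T≢∅))
                          (cut-^ (λ i → proj₁ (u>0 i)) (λ i → proj₁ (v>0 i)) R≥0 uR≡u Rv≡v k T) ⟩
    fromℕ F k * cut R T * volume T ⁻¹
      ≡⟨ *-assoc (fromℕ F k) (cut R T) (volume T ⁻¹) ⟩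
    fromℕ F k * (cut R T * volume T ⁻¹)
      ≡⟨ cong (fromℕ F k *_) (φ-set≡cut*volume⁻¹ T Rv≡v) ⟨
    fromℕ F k * φ-set F u v R T ∎

open import Data.Nat using (_≤_)

lemma3p13 : ∀ {c ℓ} (F : OrderedField c ℓ) (n : ℕ) (R : Matrix F n) (u v : Vector F n) →
              Nonnegative F R → Irreducible F R →
              Positive F u → Positive F v →
              LeftEigen1 F R u → RightEigen1 F R v →
              (k : ℕ) → 1 ≤ k →
              (φR φRk : OrderedField.Carrier F) →
              IsPhi F u v R φR → IsPhi F u v (_^_ F R k) φRk →
              OrderedField._≤_ F φRk (OrderedField._*_ F (fromℕ F k) φR)
lemma3p13 F n R u v R≥0 _ u>0 v>0 uR≡u Rv≡v k _ φR φRk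
          ((T , T-admissible , φ-set≡φR) , _) (_ , φRk-minimal) = begin
  φRk                              ≤⟨ φRk-minimal T T-admissible ⟩
  φ-set F u v (_^_ F R k) T        ≤⟨ φ-set-^ u>0 v>0 R≥0 uR≡u Rv≡v k (proj₁ T-admissible) ⟩
  fromℕ F k * φ-set F u v R T      ≡⟨ cong (fromℕ F k *_) φ-set≡φR ⟩
  fromℕ F k * φR                   ∎
  where
  open OrderedField F using (_*_)
  open OrderedFieldProperties F using (poset)
  open Conductance F u v using (φ-set-^)
  open import Relation.Binary.Reasoning.PartialOrder poset
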